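{- Let $n,k$ be positive integers. There exists an involution $\varphi$ on $\mathcal P_n^k$ such that $\mathrm{mak}(\pi)=\mathrm{mak}'(\varphi(\pi))$ for every $\pi\in\mathcal P_n^k$.
   Context: $\mathcal P_n^k$ denotes the set of set partitions of $[n]=\{1,\dots,n\}$ into $k$ blocks, written $\pi=B_1-\cdots-B_k$ with the blocks listed in increasing order of their smallest elements. Let $w_i$ be the index of the block containing $i$. The openers $\mathcal O(\pi)$ are the smallest elements of the blocks, and the closers $\mathcal F(\pi)$ are their largest elements. For $i\in[n]$ define: $\mathrm{ros}_i(\pi)=\#\{j\in\mathcal O(\pi): j<i,\ w_j>w_i\}$, $\mathrm{lcs}_i(\pi)=\#\{j\in\mathcal F(\pi): j<i,\ w_j<w_i\}$, $\mathrm{lob}_i(\pi)=\#\{j\in\mathcal O(\pi): j>i,\ w_j<w_i\}$, $\mathrm{rcb}_i(\pi)=\#\{j\in\mathcal F(\pi): j>i,\ w_j>w_i\}$. Each statistic is the sum of its coordinates over $i\in[n]$. Set $\mathrm{mak}=\mathrm{ros}+\mathrm{lcs}$ and $\mathrm{mak}'=\mathrm{lob}+\mathrm{rcb}$. -}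

module Defs where

open import Data.Nat using (ℕ; _+_; _<_; _<ᵇ_)
open import Data.Bool using (Bool; true; false; _∧_; not; if_then_else_)
open import Data.Fin using (Fin; toℕ; _≟_)
open import Data.List using (List; length; filter; allFin; map)
open import Data.Bool.ListAction using (and)
open import Data.Nat.ListAction using (sum)
open import Data.Product using (Σ; ∃; _×_; _,_; proj₁)
open import Relation.Nullary.Decidable using (⌊_⌋)
open import Relation.Binary.PropositionalEquality using (_≡_)
open import Function using (_∘_)

-- A set partition of [n] into k blocks B_1 - ... - B_k (blocks ordered by
-- their smallest elements) is encoded by its word w : [n] → [k], where
-- w i is the index of the block containing i (positions and block indices
-- are 0-based via Fin).
--   * every block is nonempty            : w is surjective
--   * blocks ordered by smallest element : if i lies in a block with index
--     bigger than j, then block j already has an element before i.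
IsBlockWord : ∀ {n k} → (Fin n → Fin k) → Set
IsBlockWord {n} {k} w =
  ((b : Fin k) → ∃ λ i → w i ≡ b) ×
  ((i : Fin n) (b : Fin k) → toℕ b < toℕ (w i) →
     ∃ λ m → (toℕ m < toℕ i) × (w m ≡ b))

SetPartition : ℕ → ℕ → Set
SetPartition n k = Σ (Fin n → Fin k) IsBlockWord

word : ∀ {n k} → SetPartition n k → Fin n → Fin k
word = proj₁

count : ∀ {n} → (Fin n → Bool) → ℕ
count {n} p = length (filter (λ j → Data.Bool._≟_ (p j) true) (allFin n))

_==_ : ∀ {k} → Fin k → Fin k → Bool
a == b = ⌊ a ≟ b ⌋

_<F_ : ∀ {m} → Fin m → Fin m → Bool
a <F b = toℕ a <ᵇ toℕ b

module _ {n k : ℕ} (π : SetPartition n k) where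
  private
    w = word π

  isOpener : Fin n → Bool
  isOpener j = and (map (λ i → not ((i <F j) ∧ (w i == w j))) (allFin n))

  isCloser : Fin n → Bool
  isCloser j = and (map (λ i → not ((j <F i) ∧ (w i == w j))) (allFin n))

  ros-at lcs-at lob-at rcb-at : Fin n → ℕ
  ros-at i = count (λ j → isOpener j ∧ (j <F i) ∧ (w i <F w j))
  lcs-at i = count (λ j → isCloser j ∧ (j <F i) ∧ (w j <F w i))
  lob-at i = count (λ j → isOpener j ∧ (i <F j) ∧ (w j <F w i))
  rcb-at i = count (λ j → isCloser j ∧ (i <F j) ∧ (w i <F w j))

  sumOver : (Fin n → ℕ) → ℕ
  sumOver f = sum (map f (allFin n))

  ros lcs lob rcb : ℕ
  ros = sumOver ros-at
  lcs = sumOver lcs-at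
  lob = sumOver lob-at
  rcb = sumOver rcb-at

  mak mak′ : ℕ
  mak  = ros + lcs
  mak′ = lob + rcb

-- Write o b and c b for the opener and closer of block b, and call b open at i when o b < i < c b.
-- Splitting ros + lcs according to where the arc of each block lies relative to i gives
--   mak π = Σᵢ #{b : c b < i} + Σᵢ #{b open at i : w i < b},
-- while lob vanishes identically and, for the reversal ρ π (the word read backwards, with the
-- blocks renumbered by their new openers),
--   mak′ (ρ π) = Σᵢ #{b : c b < i} + Σᵢ #{b open at i : c b < c (w i)}.
-- At an opener one of the two last summands vanishes and the other counts arcs crossing the arc
-- of w i, and at a closer the roles are exchanged, so both sides differ only at the transient
-- positions o (w i) < i < c (w i). There w i is itself open at i, ranked among the open blocks by
-- index in the first formula and by closer in the second. The switch σ keeps every arc and moves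
-- each transient position to the open block whose rank by closer equals the rank of w i by index,
-- so mak π = mak′ (ρ (σ π)). Reversal exchanges the two rankings, which makes φ = ρ ∘ σ an involution.

{-# OPTIONS --safe #-}
module Submission where

open import Defs
open import Data.Bool as Bool using (Bool; true; false; _∧_; if_then_else_; T)
open import Data.Bool.ListAction using (and)
open import Data.Bool.Properties using (∧-zeroʳ; ∧-identityʳ; ∧-comm; ∧-assoc; if-eta; ¬-not)
open import Data.Fin as Fin using (Fin; zero; suc; toℕ; opposite; _<_; _≤_; _≟_)
import Data.Fin.Permutation as Perm
import Data.Fin.Properties as Fin
open import Data.List using ([]; _∷_; allFin; map; filter; length; tabulate)
open import Data.List.Properties using (map-tabulate)
open import Data.Nat as ℕ using (ℕ; zero; suc; _+_; _≥_)
import Data.Nat.ListAction as List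
import Data.Nat.Properties as ℕ
open import Data.Product using (Σ; ∃; _×_; _,_; proj₁; proj₂)
open import Data.Sum using (_⊎_; inj₁; inj₂)
open import Function using (_∘_)
open import Relation.Binary.Definitions using (tri<; tri≈; tri>)
open import Relation.Binary.PropositionalEquality
open import Relation.Nullary using (yes; no; contradiction)
open import Relation.Nullary.Decidable using (dec-true; dec-false; isYes≗does; _×-dec_)
open import Relation.Unary using (Pred; Decidable)

open import Algebra.Properties.CommutativeMonoid.Sum ℕ.+-0-commutativeMonoid
  using (sum-syntax; sum-cong-≗; sum-remove; ∑-distrib-+; ∑-comm; sum-replicate-zero; ∑-permute)

𝟙 : Bool → ℕ
𝟙 true  = 1
𝟙 false = 0

𝟙-∧ : ∀ x y → 𝟙 (x ∧ y) ≡ (if x then 𝟙 y else 0)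
𝟙-∧ true  y = refl
𝟙-∧ false y = refl

∧-true⁻ : ∀ {x y} → (x ∧ y) ≡ true → x ≡ true × y ≡ true
∧-true⁻ {true} y≡true = refl , y≡true

≡-by-truth : ∀ {x y} → (x ≡ true → y ≡ true) → (y ≡ true → x ≡ true) → x ≡ y
≡-by-truth {false} {false} _ _ = refl
≡-by-truth {false} {true}  _   y⇒x = y⇒x refl
≡-by-truth {true}          x⇒y _   = sym (x⇒y refl)

not-true⁻ : ∀ {x} → Bool.not x ≡ true → x ≡ false
not-true⁻ {false} _ = refl

𝟙-mono : ∀ {x y} → (x ≡ true → y ≡ true) → 𝟙 x ℕ.≤ 𝟙 y
𝟙-mono {false} _   = ℕ.z≤n
𝟙-mono {true}  x⇒y rewrite x⇒y refl = ℕ.≤-refl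

𝟙-<⁻ : ∀ {x y} → 𝟙 x ℕ.< 𝟙 y → x ≡ false × y ≡ true
𝟙-<⁻ {false} {true} _ = refl , refl
𝟙-<⁻ {true}  {true} (ℕ.s≤s ())

module _ {m n : ℕ} where

  <ᵇ-true : m ℕ.< n → (m ℕ.<ᵇ n) ≡ true
  <ᵇ-true = dec-true (m ℕ.<? n)

  <ᵇ-false : n ℕ.≤ m → (m ℕ.<ᵇ n) ≡ false
  <ᵇ-false n≤m = dec-false (m ℕ.<? n) (ℕ.≤⇒≯ n≤m)

  <ᵇ-true⁻ : (m ℕ.<ᵇ n) ≡ true → m ℕ.< n
  <ᵇ-true⁻ e = ℕ.<ᵇ⇒< m n (subst T (sym e) _)

  <ᵇ-false⁻ : (m ℕ.<ᵇ n) ≡ false → n ℕ.≤ m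
  <ᵇ-false⁻ e = ℕ.≮⇒≥ (λ m<n → contradiction (trans (sym (<ᵇ-true m<n)) e) λ ())

<ᵇ-irrefl : ∀ m → (m ℕ.<ᵇ m) ≡ false
<ᵇ-irrefl m = <ᵇ-false (ℕ.≤-refl {m})

<ᵇ-suc : ∀ {m n} → m ≢ n → (m ℕ.<ᵇ suc n) ≡ (m ℕ.<ᵇ n)
<ᵇ-suc {zero}  {zero}  m≢n = contradiction refl m≢n
<ᵇ-suc {zero}  {suc n} _   = refl
<ᵇ-suc {suc m} {zero}  _   = refl
<ᵇ-suc {suc m} {suc n} m≢n = <ᵇ-suc (m≢n ∘ cong suc)

module _ {m : ℕ} {a b : Fin m} where

  ==-true : a ≡ b → (a == b) ≡ true
  ==-true a≡b = trans (isYes≗does (a ≟ b)) (dec-true (a ≟ b) a≡b)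

  ==-false : a ≢ b → (a == b) ≡ false
  ==-false a≢b = trans (isYes≗does (a ≟ b)) (dec-false (a ≟ b) a≢b)

  ==-true⁻ : (a == b) ≡ true → a ≡ b
  ==-true⁻ e with a ≟ b
  ... | yes a≡b = a≡b

opposite-< : ∀ {m} {i j : Fin m} → i < j → opposite j < opposite i
opposite-< {i = i} {j} i<j rewrite Fin.opposite-prop i | Fin.opposite-prop j =
  ℕ.∸-monoʳ-< (ℕ.s≤s i<j) (Fin.toℕ<n j)

opposite-injective : ∀ {m} {i j : Fin m} → opposite i ≡ opposite j → i ≡ j
opposite-injective {i = i} {j} e =
  trans (sym (Fin.opposite-involutive i)) (trans (cong opposite e) (Fin.opposite-involutive j))

opposite-≤ : ∀ {m} {i j : Fin m} → i ≤ j → opposite j ≤ opposite i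
opposite-≤ {m} {i} {j} i≤j rewrite Fin.opposite-prop i | Fin.opposite-prop j =
  ℕ.∸-monoʳ-≤ m (ℕ.s≤s i≤j)

==-opposite : ∀ {m} (a b : Fin m) → (opposite a == opposite b) ≡ (a == b)
==-opposite a b =
  ≡-by-truth (==-true ∘ opposite-injective ∘ ==-true⁻) (==-true ∘ cong opposite ∘ ==-true⁻)

opposite-<F : ∀ {m} (i j : Fin m) → (opposite i <F opposite j) ≡ (j <F i)
opposite-<F i j with Fin.<-cmp i j
... | tri< i<j _ _ = trans (<ᵇ-false (ℕ.<⇒≤ (opposite-< i<j))) (sym (<ᵇ-false (ℕ.<⇒≤ i<j)))
... | tri≈ _ refl _ = trans (<ᵇ-irrefl (toℕ (opposite i))) (sym (<ᵇ-irrefl (toℕ i)))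
... | tri> _ _ j<i = trans (<ᵇ-true (opposite-< j<i)) (sym (<ᵇ-true j<i))

∑-zero : ∀ {m} {f : Fin m → ℕ} → (∀ i → f i ≡ 0) → ∑[ i < m ] f i ≡ 0
∑-zero {m} f≗0 = trans (sum-cong-≗ f≗0) (sum-replicate-zero m)

∑-delta : ∀ {m} (x : Fin m) (f : Fin m → ℕ) → ∑[ i < m ] (if x == i then f i else 0) ≡ f x
∑-delta {suc m} x f = begin
  ∑[ i < suc m ] δ i                     ≡⟨ sum-remove {i = x} δ ⟩
  δ x + ∑[ j < m ] δ (Fin.punchIn x j)   ≡⟨ cong₂ _+_ (cong (if_then f x else 0) (==-true refl))
                                                      (∑-zero λ j → δ-off (Fin.punchIn x j) (Fin.punchInᵢ≢i x j ∘ sym)) ⟩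
  f x + 0                                ≡⟨ ℕ.+-identityʳ (f x) ⟩
  f x                                    ∎
  where
  open ≡-Reasoning
  δ : Fin (suc m) → ℕ
  δ i = if x == i then f i else 0
  δ-off : ∀ i → x ≢ i → δ i ≡ 0
  δ-off i x≢i = cong (if_then f i else 0) (==-false x≢i)

∑-𝟙-true : ∀ m → ∑[ a < m ] 𝟙 true ≡ m
∑-𝟙-true zero    = refl
∑-𝟙-true (suc m) = cong suc (∑-𝟙-true m)

∑-mono-≤ : ∀ {m} {f g : Fin m → ℕ} → (∀ i → f i ℕ.≤ g i) → ∑[ i < m ] f i ℕ.≤ ∑[ i < m ] g i
∑-mono-≤ {zero}  f≤g = ℕ.z≤n
∑-mono-≤ {suc m} f≤g = ℕ.+-mono-≤ (f≤g zero) (∑-mono-≤ (f≤g ∘ suc))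

∑-mono-< : ∀ {m} {f g : Fin m → ℕ} → (∀ i → f i ℕ.≤ g i) → (x : Fin m) → f x ℕ.< g x →
           ∑[ i < m ] f i ℕ.< ∑[ i < m ] g i
∑-mono-< f≤g zero    fx<gx = ℕ.+-mono-<-≤ fx<gx (∑-mono-≤ (f≤g ∘ suc))
∑-mono-< f≤g (suc x) fx<gx = ℕ.+-mono-≤-< (f≤g zero) (∑-mono-< (f≤g ∘ suc) x fx<gx)

∑-<⇒∃-< : ∀ {m} (f g : Fin m → ℕ) → ∑[ i < m ] f i ℕ.< ∑[ i < m ] g i → ∃ λ i → f i ℕ.< g i
∑-<⇒∃-< {suc m} f g ∑f<∑g with f zero ℕ.<? g zero
... | yes f₀<g₀ = zero , f₀<g₀
... | no  f₀≮g₀ with ∑-<⇒∃-< (f ∘ suc) (g ∘ suc) (ℕ.+-cancelˡ-< (f zero) _ _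
                      (ℕ.<-≤-trans ∑f<∑g (ℕ.+-monoˡ-≤ _ (ℕ.≮⇒≥ f₀≮g₀))))
...   | i , fi<gi = suc i , fi<gi

∑-bijection : ∀ {m} (f : Fin m → ℕ) (τ : Fin m → Fin m) →
              (∀ {a b} → τ a ≡ τ b → a ≡ b) → (∀ t → ∃ λ a → τ a ≡ t) →
              ∑[ i < m ] f i ≡ ∑[ i < m ] f (τ i)
∑-bijection f τ τ-injective τ-surjective =
  ∑-permute f (Perm.permutation τ τ⁻¹ (proj₂ ∘ τ-surjective) (τ-injective ∘ proj₂ ∘ τ-surjective ∘ τ))
  where
  τ⁻¹ = proj₁ ∘ τ-surjective

∑-reverse : ∀ {m} (f : Fin m → ℕ) → ∑[ i < m ] f i ≡ ∑[ i < m ] f (opposite i)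
∑-reverse f = ∑-bijection f opposite opposite-injective (λ t → opposite t , Fin.opposite-involutive t)

∑-𝟙-<F : ∀ {m} (b : Fin m) → ∑[ a < m ] 𝟙 (a <F b) ≡ toℕ b
∑-𝟙-<F {suc m} zero    = ∑-zero {m} (λ _ → refl)
∑-𝟙-<F {suc m} (suc b) = cong suc (∑-𝟙-<F b)

∑-section : ∀ {m l} (r : Fin m → Fin l) (s : Fin l → Fin m) → (∀ b → r (s b) ≡ b) →
            (h : Fin m → Fin l → ℕ) →
            ∑[ j < m ] (if s (r j) == j then h j (r j) else 0) ≡ ∑[ b < l ] h (s b) b
∑-section {m} {l} r s r∘s≗id h = begin
  ∑[ j < m ] (if s (r j) == j then h j (r j) else 0)      ≡⟨ sum-cong-≗ spread ⟩
  ∑[ j < m ] ∑[ b < l ] (if s b == j then h j b else 0)  ≡⟨ ∑-comm (λ j b → if s b == j then h j b else 0) ⟩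
  ∑[ b < l ] ∑[ j < m ] (if s b == j then h j b else 0)  ≡⟨ sum-cong-≗ (λ b → ∑-delta (s b) (λ j → h j b)) ⟩
  ∑[ b < l ] h (s b) b                                   ∎
  where
  open ≡-Reasoning
  spread : ∀ j → (if s (r j) == j then h j (r j) else 0) ≡ ∑[ b < l ] (if s b == j then h j b else 0)
  spread j with s (r j) ≟ j
  ... | yes s∘r≡id = sym (trans (sum-cong-≗ (λ b → cong (if_then h j b else 0) (section-== b)))
                                 (∑-delta (r j) (h j)))
    where
    section-== : ∀ b → (s b == j) ≡ (r j == b)
    section-== b = ≡-by-truth (λ sb≡j → ==-true (trans (cong r (sym (==-true⁻ sb≡j))) (r∘s≗id b)))
                              (λ rj≡b → ==-true (trans (cong s (sym (==-true⁻ rj≡b))) s∘r≡id))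
  ... | no s∘r≢id = sym (∑-zero λ b → cong (if_then h j b else 0) (==-false λ sb≡j →
                      s∘r≢id (trans (cong (s ∘ r) (sym sb≡j)) (trans (cong s (r∘s≗id b)) sb≡j))))

sum-tabulate : ∀ {m} (f : Fin m → ℕ) → List.sum (tabulate f) ≡ ∑[ i < m ] f i
sum-tabulate {zero}  f = refl
sum-tabulate {suc m} f = cong (f zero +_) (sum-tabulate (f ∘ suc))

sumOver≡∑ : ∀ {m} (f : Fin m → ℕ) → List.sum (map f (allFin m)) ≡ ∑[ i < m ] f i
sumOver≡∑ f = trans (cong List.sum (map-tabulate (λ i → i) f)) (sum-tabulate f)

count≡∑ : ∀ {m} (p : Fin m → Bool) → count p ≡ ∑[ j < m ] 𝟙 (p j)
count≡∑ {m} p = begin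
  length (filter (λ j → p j Bool.≟ true) (allFin m)) ≡⟨ length-filter (allFin m) ⟩
  List.sum (map (𝟙 ∘ p) (allFin m))                  ≡⟨ sumOver≡∑ (𝟙 ∘ p) ⟩
  ∑[ j < m ] 𝟙 (p j)                                 ∎
  where
  open ≡-Reasoning
  length-filter : ∀ xs → length (filter (λ j → p j Bool.≟ true) xs) ≡ List.sum (map (𝟙 ∘ p) xs)
  length-filter [] = refl
  length-filter (x ∷ xs) with p x
  ... | true  = cong suc (length-filter xs)
  ... | false = length-filter xs

and-tabulate⁺ : ∀ {m} (f : Fin m → Bool) → (∀ i → f i ≡ true) → and (tabulate f) ≡ true
and-tabulate⁺ {zero}  f _        = refl
and-tabulate⁺ {suc m} f all-true rewrite all-true zero = and-tabulate⁺ (f ∘ suc) (all-true ∘ suc)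

and-tabulate⁻ : ∀ {m} (f : Fin m → Bool) → and (tabulate f) ≡ true → ∀ i → f i ≡ true
and-tabulate⁻ {suc m} f all-true i with f zero in f₀ | i
... | true  | zero  = f₀
... | true  | suc i = and-tabulate⁻ (f ∘ suc) all-true i
... | false | _     = contradiction all-true λ ()

and-allFin⁺ : ∀ {m} (f : Fin m → Bool) → (∀ i → f i ≡ true) → and (map f (allFin m)) ≡ true
and-allFin⁺ f = subst (λ xs → and xs ≡ true) (sym (map-tabulate (λ i → i) f)) ∘ and-tabulate⁺ f

and-allFin⁻ : ∀ {m} (f : Fin m → Bool) → and (map f (allFin m)) ≡ true → ∀ i → f i ≡ true
and-allFin⁻ f = and-tabulate⁻ f ∘ subst (λ xs → and xs ≡ true) (map-tabulate (λ i → i) f)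

-- Extremal elements and ranks

least : ∀ {m ℓ} {P : Pred (Fin m) ℓ} → Decidable P → ∃ P → ∃ λ j → P j × (∀ l → P l → j ≤ l)
least {suc m} P? (i , Pi) with P? zero
... | yes P₀ = zero , P₀ , λ _ _ → ℕ.z≤n
... | no ¬P₀ with i
...   | zero  = contradiction Pi ¬P₀
...   | suc i with least (P? ∘ suc) (i , Pi)
...     | j , Pj , j-least = suc j , Pj , λ where
            zero    Pl → contradiction Pl ¬P₀
            (suc l) Pl → ℕ.s≤s (j-least l Pl)

greatest : ∀ {m ℓ} {P : Pred (Fin m) ℓ} → Decidable P → ∃ P → ∃ λ j → P j × (∀ l → P l → l ≤ j)
greatest {P = P} P? (i , Pi) =
  let j , Pj , j-least = least (P? ∘ opposite) (opposite i , P-opposite² Pi)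
  in opposite j , Pj , λ l Pl → subst (_≤ opposite j) (Fin.opposite-involutive l)
                                  (opposite-≤ (j-least (opposite l) (P-opposite² Pl)))
  where
  P-opposite² : ∀ {l} → P l → P (opposite (opposite l))
  P-opposite² {l} = subst P (sym (Fin.opposite-involutive l))

module Rank {k n : ℕ} (P : Fin k → Bool) (key : Fin k → Fin n)
            (key-injective : ∀ {a b} → P a ≡ true → P b ≡ true → key a ≡ key b → a ≡ b) where

  countBelow : ℕ → ℕ
  countBelow t = ∑[ a < k ] 𝟙 (P a ∧ (toℕ (key a) ℕ.<ᵇ t))

  rank : Fin k → ℕ
  rank b = countBelow (toℕ (key b))

  size : ℕ
  size = ∑[ a < k ] 𝟙 (P a)

  countBelow-zero : countBelow 0 ≡ 0
  countBelow-zero = ∑-zero (λ a → cong 𝟙 (∧-zeroʳ (P a)))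

  countBelow-all : countBelow n ≡ size
  countBelow-all = sum-cong-≗ λ a →
    cong 𝟙 (trans (cong (P a ∧_) (<ᵇ-true (Fin.toℕ<n (key a)))) (∧-identityʳ (P a)))

  countBelow-mono : ∀ {t t′} → t ℕ.≤ t′ → countBelow t ℕ.≤ countBelow t′
  countBelow-mono t≤t′ = ∑-mono-≤ {k} λ a → 𝟙-mono λ below-t →
    let Pa , ka<t = ∧-true⁻ below-t in cong₂ _∧_ Pa (<ᵇ-true (ℕ.<-≤-trans (<ᵇ-true⁻ ka<t) t≤t′))

  countBelow-suc : ∀ {a} → P a ≡ true → countBelow (suc (toℕ (key a))) ≡ suc (rank a)
  countBelow-suc {a} Pa = begin
    countBelow (suc (toℕ (key a)))
      ≡⟨ sum-cong-≗ split ⟩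
    ∑[ x < k ] (𝟙 (P x ∧ (key x <F key a)) + (if a == x then 1 else 0))
      ≡⟨ ∑-distrib-+ (λ x → 𝟙 (P x ∧ (key x <F key a))) (λ x → if a == x then 1 else 0) ⟩
    rank a + ∑[ x < k ] (if a == x then 1 else 0)
      ≡⟨ cong (rank a +_) (∑-delta a (λ _ → 1)) ⟩
    rank a + 1
      ≡⟨ ℕ.+-comm (rank a) 1 ⟩
    suc (rank a) ∎
    where
    open ≡-Reasoning
    split : ∀ x → 𝟙 (P x ∧ (toℕ (key x) ℕ.<ᵇ suc (toℕ (key a)))) ≡
                  𝟙 (P x ∧ (key x <F key a)) + (if a == x then 1 else 0)
    split x with a ≟ x
    ... | yes refl rewrite Pa | <ᵇ-irrefl (toℕ (key a))
                         | <ᵇ-true (ℕ.n<1+n (toℕ (key a))) = refl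
    ... | no a≢x rewrite ℕ.+-identityʳ (𝟙 (P x ∧ (key x <F key a))) with P x in Px
    ...   | false = refl
    ...   | true  = cong 𝟙 (<ᵇ-suc (a≢x ∘ key-injective Pa Px ∘ sym ∘ Fin.toℕ-injective))

  rank-< : ∀ {a b} → P a ≡ true → key a < key b → rank a ℕ.< rank b
  rank-< Pa ka<kb = ℕ.<-≤-trans (ℕ.≤-reflexive (sym (countBelow-suc Pa))) (countBelow-mono ka<kb)

  rank-injective : ∀ {a b} → P a ≡ true → P b ≡ true → rank a ≡ rank b → a ≡ b
  rank-injective {a} {b} Pa Pb ra≡rb with Fin.<-cmp (key a) (key b)
  ... | tri< ka<kb _ _ = contradiction ra≡rb (ℕ.<⇒≢ (rank-< Pa ka<kb))
  ... | tri≈ _ ka≡kb _ = key-injective Pa Pb ka≡kb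
  ... | tri> _ _ kb<ka = contradiction (sym ra≡rb) (ℕ.<⇒≢ (rank-< Pb kb<ka))

  rank-<ᵇ : ∀ {a b} → P a ≡ true → P b ≡ true → (rank a ℕ.<ᵇ rank b) ≡ (key a <F key b)
  rank-<ᵇ {a} {b} Pa Pb with Fin.<-cmp (key a) (key b)
  ... | tri< ka<kb _ _ = trans (<ᵇ-true (rank-< Pa ka<kb)) (sym (<ᵇ-true ka<kb))
  ... | tri≈ _ ka≡kb _ rewrite key-injective Pa Pb ka≡kb =
    trans (<ᵇ-irrefl (rank b)) (sym (<ᵇ-irrefl (toℕ (key b))))
  ... | tri> _ _ kb<ka = trans (<ᵇ-false (ℕ.<⇒≤ (rank-< Pb kb<ka))) (sym (<ᵇ-false (ℕ.<⇒≤ kb<ka)))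

  rank<size : ∀ {b} → P b ≡ true → rank b ℕ.< size
  rank<size {b} Pb = ℕ.<-≤-trans (ℕ.≤-reflexive (sym (countBelow-suc Pb)))
                       (ℕ.≤-trans (countBelow-mono (Fin.toℕ<n (key b))) (ℕ.≤-reflexive countBelow-all))

  Ranked : ℕ → Fin k → Set
  Ranked r b = P b ≡ true × rank b ≡ r

  countBelow-jump : ∀ {t} a →
    𝟙 (P a ∧ (toℕ (key a) ℕ.<ᵇ t)) ℕ.< 𝟙 (P a ∧ (toℕ (key a) ℕ.<ᵇ suc t)) → P a ≡ true × toℕ (key a) ≡ t
  countBelow-jump {t} a jump with P a | 𝟙-<⁻ jump
  ... | true | ka≮t , ka<t+1 = refl , ℕ.≤-antisym (ℕ.s≤s⁻¹ (<ᵇ-true⁻ ka<t+1)) (<ᵇ-false⁻ ka≮t)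

  -- countBelow climbs from 0 to size, and each step is a jump by one at the key of an element of P.
  rank-surjective-below : ∀ t {r} → r ℕ.< countBelow t → ∃ (Ranked r)
  rank-surjective-below zero r<0 = contradiction (subst (_ ℕ.<_) countBelow-zero r<0) λ ()
  rank-surjective-below (suc t) {r} r<next with r ℕ.<? countBelow t
  ... | yes r<cur = rank-surjective-below t r<cur
  ... | no  r≮cur
    with a , jump ← ∑-<⇒∃-< _ _ (ℕ.≤-<-trans (ℕ.≮⇒≥ r≮cur) r<next)
    with Pa , refl ← countBelow-jump a jump
    = a , Pa , ℕ.≤-antisym (ℕ.≮⇒≥ r≮cur) (ℕ.s≤s⁻¹ (subst (r ℕ.<_) (countBelow-suc Pa) r<next))

  rank-surjective : ∀ {r} → r ℕ.< size → ∃ (Ranked r)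
  rank-surjective r<size = rank-surjective-below n (subst (_ ℕ.<_) (sym countBelow-all) r<size)

  -- The default is a junk value, returned only when no element of P has rank r.
  unrank : Fin k → ℕ → Fin k
  unrank default r with Fin.any? (λ b → (P b Bool.≟ true) ×-dec (rank b ℕ.≟ r))
  ... | yes (b , _) = b
  ... | no  _       = default

  unrank-ranked : ∀ default {r} → r ℕ.< size → Ranked r (unrank default r)
  unrank-ranked default {r} r<size with Fin.any? (λ b → (P b Bool.≟ true) ×-dec (rank b ℕ.≟ r))
  ... | yes (b , ranked) = ranked
  ... | no  ∄ranked      = contradiction (rank-surjective r<size) ∄ranked

-- Arcs of a partition

module _ {n k : ℕ} (π : SetPartition n k) where

  private
    w = word π

    inBlock? : (b : Fin k) → Decidable (λ j → w j ≡ b)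
    inBlock? b j = w j ≟ b

    first : (b : Fin k) → ∃ λ j → w j ≡ b × (∀ l → w l ≡ b → j ≤ l)
    first b = least (inBlock? b) (proj₁ (proj₂ π) b)

    last : (b : Fin k) → ∃ λ j → w j ≡ b × (∀ l → w l ≡ b → l ≤ j)
    last b = greatest (inBlock? b) (proj₁ (proj₂ π) b)

  opaque
    opener closer : Fin k → Fin n
    opener b = proj₁ (first b)
    closer b = proj₁ (last b)

    word-opener : ∀ b → w (opener b) ≡ b
    word-opener b = proj₁ (proj₂ (first b))

    word-closer : ∀ b → w (closer b) ≡ b
    word-closer b = proj₁ (proj₂ (last b))

    opener-least : ∀ {b} j → w j ≡ b → opener b ≤ j
    opener-least {b} = proj₂ (proj₂ (first b))

    closer-greatest : ∀ {b} j → w j ≡ b → j ≤ closer b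
    closer-greatest {b} = proj₂ (proj₂ (last b))

  opener-≤ : ∀ j → opener (w j) ≤ j
  opener-≤ j = opener-least j refl

  ≤-closer : ∀ j → j ≤ closer (w j)
  ≤-closer j = closer-greatest j refl

  opener≤closer : ∀ b → opener b ≤ closer b
  opener≤closer b = opener-least (closer b) (word-closer b)

  closer-injective : ∀ {a b} → closer a ≡ closer b → a ≡ b
  closer-injective {a} {b} ca≡cb = trans (sym (word-closer a)) (trans (cong w ca≡cb) (word-closer b))

  opener-< : ∀ {a b} → a < b → opener a < opener b
  opener-< {a} {b} a<b
    with j , j<ob , wj≡a ← proj₂ (proj₂ π) (opener b) a (subst (a <_) (sym (word-opener b)) a<b)
    = ℕ.≤-<-trans (opener-least j wj≡a) j<ob

  opener-<F : ∀ a b → (opener a <F opener b) ≡ (a <F b)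
  opener-<F a b with Fin.<-cmp a b
  ... | tri< a<b _ _ = trans (<ᵇ-true (opener-< a<b)) (sym (<ᵇ-true a<b))
  ... | tri≈ _ refl _ = trans (<ᵇ-irrefl (toℕ (opener a))) (sym (<ᵇ-irrefl (toℕ a)))
  ... | tri> _ _ b<a = trans (<ᵇ-false (ℕ.<⇒≤ (opener-< b<a))) (sym (<ᵇ-false (ℕ.<⇒≤ b<a)))

  isOpener≡ : ∀ j → isOpener π j ≡ (opener (w j) == j)
  isOpener≡ j = ≡-by-truth first-in-block first-is-opener
    where
    first-in-block : isOpener π j ≡ true → (opener (w j) == j) ≡ true
    first-in-block opens = ==-true (Fin.≤-antisym (opener-≤ j) (<ᵇ-false⁻ earlier-false))
      where
      earlier-false : (opener (w j) <F j) ≡ false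
      earlier-false = trans (sym (∧-identityʳ _))
        (trans (cong ((opener (w j) <F j) ∧_) (sym (==-true (word-opener (w j)))))
               (not-true⁻ (and-allFin⁻ _ opens (opener (w j)))))
    first-is-opener : (opener (w j) == j) ≡ true → isOpener π j ≡ true
    first-is-opener first = and-allFin⁺ _ λ i → cong Bool.not (not-earlier i)
      where
      not-earlier : ∀ i → ((i <F j) ∧ (w i == w j)) ≡ false
      not-earlier i with w i ≟ w j
      ... | no  _     = ∧-zeroʳ (i <F j)
      ... | yes wi≡wj = cong (_∧ true) (<ᵇ-false (subst (_≤ i) (==-true⁻ first) (opener-least i wi≡wj)))

  isCloser≡ : ∀ j → isCloser π j ≡ (closer (w j) == j)
  isCloser≡ j = ≡-by-truth last-in-block last-is-closer
    where
    last-in-block : isCloser π j ≡ true → (closer (w j) == j) ≡ true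
    last-in-block closes = ==-true (Fin.≤-antisym (<ᵇ-false⁻ later-false) (≤-closer j))
      where
      later-false : (j <F closer (w j)) ≡ false
      later-false = trans (sym (∧-identityʳ _))
        (trans (cong ((j <F closer (w j)) ∧_) (sym (==-true (word-closer (w j)))))
               (not-true⁻ (and-allFin⁻ _ closes (closer (w j)))))
    last-is-closer : (closer (w j) == j) ≡ true → isCloser π j ≡ true
    last-is-closer last = and-allFin⁺ _ λ i → cong Bool.not (not-later i)
      where
      not-later : ∀ i → ((j <F i) ∧ (w i == w j)) ≡ false
      not-later i with w i ≟ w j
      ... | no  _     = ∧-zeroʳ (j <F i)
      ... | yes wi≡wj = cong (_∧ true) (<ᵇ-false (subst (i ≤_) (==-true⁻ last) (closer-greatest i wi≡wj)))

  ∑-openers : (h : Fin n → Fin k → ℕ) →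
              ∑[ j < n ] (if isOpener π j then h j (w j) else 0) ≡ ∑[ b < k ] h (opener b) b
  ∑-openers h = trans (sum-cong-≗ λ j → cong (if_then h j (w j) else 0) (isOpener≡ j))
                      (∑-section w opener word-opener h)

  ∑-closers : (h : Fin n → Fin k → ℕ) →
              ∑[ j < n ] (if isCloser π j then h j (w j) else 0) ≡ ∑[ b < k ] h (closer b) b
  ∑-closers h = trans (sum-cong-≗ λ j → cong (if_then h j (w j) else 0) (isCloser≡ j))
                      (∑-section w closer word-closer h)

  count-openers : (g : Fin n → Fin k → Bool) →
                  count (λ j → isOpener π j ∧ g j (w j)) ≡ ∑[ b < k ] 𝟙 (g (opener b) b)
  count-openers g = begin
    count (λ j → isOpener π j ∧ g j (w j))                 ≡⟨ count≡∑ (λ j → isOpener π j ∧ g j (w j)) ⟩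
    ∑[ j < n ] 𝟙 (isOpener π j ∧ g j (w j))                ≡⟨ sum-cong-≗ (λ j → 𝟙-∧ (isOpener π j) (g j (w j))) ⟩
    ∑[ j < n ] (if isOpener π j then 𝟙 (g j (w j)) else 0) ≡⟨ ∑-openers (λ j b → 𝟙 (g j b)) ⟩
    ∑[ b < k ] 𝟙 (g (opener b) b)                          ∎
    where open ≡-Reasoning

  count-closers : (g : Fin n → Fin k → Bool) →
                  count (λ j → isCloser π j ∧ g j (w j)) ≡ ∑[ b < k ] 𝟙 (g (closer b) b)
  count-closers g = begin
    count (λ j → isCloser π j ∧ g j (w j))                 ≡⟨ count≡∑ (λ j → isCloser π j ∧ g j (w j)) ⟩
    ∑[ j < n ] 𝟙 (isCloser π j ∧ g j (w j))                ≡⟨ sum-cong-≗ (λ j → 𝟙-∧ (isCloser π j) (g j (w j))) ⟩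
    ∑[ j < n ] (if isCloser π j then 𝟙 (g j (w j)) else 0) ≡⟨ ∑-closers (λ j b → 𝟙 (g j b)) ⟩
    ∑[ b < k ] 𝟙 (g (closer b) b)                          ∎
    where open ≡-Reasoning

  openAt : Fin n → Fin k → Bool
  openAt i b = (opener b <F i) ∧ (i <F closer b)

  transient : Fin n → Bool
  transient i = openAt i (w i)

  transient⊎opener⊎closer : ∀ i → transient i ≡ true ⊎ i ≡ opener (w i) ⊎ i ≡ closer (w i)
  transient⊎opener⊎closer i with Fin.<-cmp (opener (w i)) i | Fin.<-cmp i (closer (w i))
  ... | tri< o<i _ _ | tri< i<c _ _ = inj₁ (cong₂ _∧_ (<ᵇ-true o<i) (<ᵇ-true i<c))
  ... | tri≈ _ o≡i _ | _            = inj₂ (inj₁ (sym o≡i))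
  ... | _            | tri≈ _ i≡c _ = inj₂ (inj₂ i≡c)
  ... | tri> _ _ i<o | _            = contradiction (opener-≤ i) (ℕ.<⇒≱ i<o)
  ... | _            | tri> _ _ c<i = contradiction (≤-closer i) (ℕ.<⇒≱ c<i)

  transient⇒opener≢ : ∀ {i} → transient i ≡ true → opener (w i) ≢ i
  transient⇒opener≢ tr o≡i = ℕ.<⇒≢ (<ᵇ-true⁻ (proj₁ (∧-true⁻ tr))) (cong toℕ o≡i)

  transient⇒closer≢ : ∀ {i} → transient i ≡ true → closer (w i) ≢ i
  transient⇒closer≢ tr c≡i = ℕ.<⇒≢ (<ᵇ-true⁻ (proj₂ (∧-true⁻ tr))) (cong toℕ (sym c≡i))

  closedBefore : Fin n → ℕ
  closedBefore i = ∑[ b < k ] 𝟙 (closer b <F i)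

  openAbove : Fin n → Fin k → ℕ
  openAbove i a = ∑[ b < k ] 𝟙 (openAt i b ∧ (a <F b))

  openClosingEarlier : Fin n → Fin k → ℕ
  openClosingEarlier i a = ∑[ b < k ] 𝟙 (openAt i b ∧ (closer b <F closer a))

  crossings : ℕ
  crossings =
    ∑[ a < k ] ∑[ b < k ] 𝟙 (((opener a <F opener b) ∧ (opener b <F closer a)) ∧ (closer a <F closer b))

  mak≡∑closedBefore+∑openAbove : mak π ≡ ∑[ i < n ] closedBefore i + ∑[ i < n ] openAbove i (w i)
  mak≡∑closedBefore+∑openAbove = begin
    sumOver π (ros-at π) + sumOver π (lcs-at π)          ≡⟨ cong₂ _+_ (sumOver≡∑ (ros-at π)) (sumOver≡∑ (lcs-at π)) ⟩
    ∑[ i < n ] ros-at π i + ∑[ i < n ] lcs-at π i        ≡⟨ ∑-distrib-+ (ros-at π) (lcs-at π) ⟨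
    ∑[ i < n ] (ros-at π i + lcs-at π i)                 ≡⟨ sum-cong-≗ ros+lcs-at ⟩
    ∑[ i < n ] (closedBefore i + openAbove i (w i))      ≡⟨ ∑-distrib-+ closedBefore (λ i → openAbove i (w i)) ⟩
    ∑[ i < n ] closedBefore i + ∑[ i < n ] openAbove i (w i) ∎
    where
    open ≡-Reasoning
    -- For b < w i both sides are [c b < i]; for w i < b, [o b < i] = [c b < i] + [o b < i < c b].
    summand : ∀ i b → 𝟙 ((opener b <F i) ∧ (w i <F b)) + 𝟙 ((closer b <F i) ∧ (b <F w i)) ≡
                      𝟙 (closer b <F i) + 𝟙 (openAt i b ∧ (w i <F b))
    summand i b with Fin.<-cmp b (w i)
    ... | tri< b<wi _ _ rewrite <ᵇ-false (ℕ.<⇒≤ b<wi) | <ᵇ-true b<wi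
                        | ∧-zeroʳ (opener b <F i) | ∧-zeroʳ (openAt i b) | ∧-identityʳ (closer b <F i)
                        = ℕ.+-comm 0 _
    ... | tri≈ _ refl _ rewrite <ᵇ-irrefl (toℕ b) | <ᵇ-false (≤-closer i)
                        | ∧-zeroʳ (opener b <F i) | ∧-zeroʳ (openAt i b) = refl
    ... | tri> _ _ wi<b rewrite <ᵇ-true wi<b | <ᵇ-false (ℕ.<⇒≤ wi<b)
                        | ∧-identityʳ (opener b <F i) | ∧-zeroʳ (closer b <F i) | ∧-identityʳ (openAt i b)
      with Fin.<-cmp (closer b) i
    ...   | tri< c<i _ _ rewrite <ᵇ-true c<i | <ᵇ-true (ℕ.≤-<-trans (opener≤closer b) c<i)
                         | <ᵇ-false (ℕ.<⇒≤ c<i) = refl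
    ...   | tri≈ _ refl _ = contradiction (word-closer b) (Fin.<⇒≢ wi<b)
    ...   | tri> _ _ i<c rewrite <ᵇ-false (ℕ.<⇒≤ i<c) | <ᵇ-true i<c | ∧-identityʳ (opener b <F i) = ℕ.+-comm _ 0
    ros+lcs-at : ∀ i → ros-at π i + lcs-at π i ≡ closedBefore i + openAbove i (w i)
    ros+lcs-at i = begin
      ros-at π i + lcs-at π i
        ≡⟨ cong₂ _+_ (count-openers λ j b → (j <F i) ∧ (w i <F b))
                     (count-closers λ j b → (j <F i) ∧ (b <F w i)) ⟩
      ∑[ b < k ] 𝟙 ((opener b <F i) ∧ (w i <F b)) + ∑[ b < k ] 𝟙 ((closer b <F i) ∧ (b <F w i))
        ≡⟨ ∑-distrib-+ (λ b → 𝟙 ((opener b <F i) ∧ (w i <F b))) (λ b → 𝟙 ((closer b <F i) ∧ (b <F w i))) ⟨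
      ∑[ b < k ] (𝟙 ((opener b <F i) ∧ (w i <F b)) + 𝟙 ((closer b <F i) ∧ (b <F w i)))
        ≡⟨ sum-cong-≗ (summand i) ⟩
      ∑[ b < k ] (𝟙 (closer b <F i) + 𝟙 (openAt i b ∧ (w i <F b)))
        ≡⟨ ∑-distrib-+ (λ b → 𝟙 (closer b <F i)) (λ b → 𝟙 (openAt i b ∧ (w i <F b))) ⟩
      closedBefore i + openAbove i (w i) ∎

  lob≡0 : lob π ≡ 0
  lob≡0 = trans (sumOver≡∑ (lob-at π)) (∑-zero λ i →
            trans (count-openers λ j b → (i <F j) ∧ (b <F w i)) (∑-zero (later-opener-of-smaller-block i)))
    where
    later-opener-of-smaller-block : ∀ i b → 𝟙 ((i <F opener b) ∧ (b <F w i)) ≡ 0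
    later-opener-of-smaller-block i b with Fin.<-cmp b (w i)
    ... | tri< b<wi _ _ rewrite <ᵇ-false (ℕ.<⇒≤ (ℕ.<-≤-trans (opener-< b<wi) (opener-≤ i))) = refl
    ... | tri≈ _ refl _ rewrite <ᵇ-irrefl (toℕ b) = cong 𝟙 (∧-zeroʳ _)
    ... | tri> _ _ wi<b rewrite <ᵇ-false (ℕ.<⇒≤ wi<b) = cong 𝟙 (∧-zeroʳ _)

  openAbove-at-opener : ∀ {i} → opener (w i) ≡ i → openAbove i (w i) ≡ 0
  openAbove-at-opener {i} o≡i = ∑-zero none-open-above
    where
    none-open-above : ∀ b → 𝟙 (openAt i b ∧ (w i <F b)) ≡ 0
    none-open-above b with Fin.<-cmp (w i) b
    ... | tri< wi<b _ _ rewrite <ᵇ-false (subst (_≤ opener b) o≡i (ℕ.<⇒≤ (opener-< wi<b))) = refl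
    ... | tri≈ _ refl _ rewrite <ᵇ-irrefl (toℕ b) | ∧-zeroʳ (openAt i b) = refl
    ... | tri> _ _ b<wi rewrite <ᵇ-false (ℕ.<⇒≤ b<wi) | ∧-zeroʳ (openAt i b) = refl

  openClosingEarlier-at-closer : ∀ {i} → closer (w i) ≡ i → openClosingEarlier i (w i) ≡ 0
  openClosingEarlier-at-closer {i} c≡i rewrite c≡i = ∑-zero none-closing-earlier
    where
    none-closing-earlier : ∀ b → 𝟙 (openAt i b ∧ (closer b <F i)) ≡ 0
    none-closing-earlier b with Fin.<-cmp i (closer b)
    ... | tri< i<c _ _ rewrite <ᵇ-false (ℕ.<⇒≤ i<c) | ∧-zeroʳ (openAt i b) = refl
    ... | tri≈ _ refl _ rewrite <ᵇ-irrefl (toℕ i) | ∧-zeroʳ (opener b <F i) = refl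
    ... | tri> _ _ c<i rewrite <ᵇ-false (ℕ.<⇒≤ c<i) | ∧-zeroʳ (opener b <F i) = refl

  -- A non-transient position is an opener, where openAbove vanishes, or a closer, where it counts crossings.
  ∑-openAbove-split : ∑[ i < n ] openAbove i (w i) ≡
                      ∑[ i < n ] (if transient i then openAbove i (w i) else 0) + crossings
  ∑-openAbove-split = begin
    ∑[ i < n ] U i
      ≡⟨ sum-cong-≗ split ⟩
    ∑[ i < n ] ((if transient i then U i else 0) + (if isCloser π i then U i else 0))
      ≡⟨ ∑-distrib-+ (λ i → if transient i then U i else 0) (λ i → if isCloser π i then U i else 0) ⟩
    ∑[ i < n ] (if transient i then U i else 0) + ∑[ i < n ] (if isCloser π i then U i else 0)
      ≡⟨ cong (∑[ i < n ] (if transient i then U i else 0) +_)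
           (trans (∑-closers openAbove) (sum-cong-≗ λ a → sum-cong-≗ λ b → cong 𝟙 (crossing a b))) ⟩
    ∑[ i < n ] (if transient i then U i else 0) + crossings ∎
    where
    open ≡-Reasoning
    U : Fin n → ℕ
    U i = openAbove i (w i)
    split : ∀ i → U i ≡ (if transient i then U i else 0) + (if isCloser π i then U i else 0)
    split i with transient i in tr | transient⊎opener⊎closer i
    ... | true  | _ rewrite isCloser≡ i | ==-false (transient⇒closer≢ tr) = sym (ℕ.+-identityʳ (U i))
    ... | false | inj₂ (inj₁ i≡o) rewrite openAbove-at-opener (sym i≡o) = sym (if-eta (isCloser π i))
    ... | false | inj₂ (inj₂ i≡c) rewrite isCloser≡ i | ==-true (sym i≡c) = refl
    crossing : ∀ a b → (openAt (closer a) b ∧ (a <F b)) ≡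
                       (((opener a <F opener b) ∧ (opener b <F closer a)) ∧ (closer a <F closer b))
    crossing a b = begin
      openAt (closer a) b ∧ (a <F b)                  ≡⟨ ∧-comm (openAt (closer a) b) (a <F b) ⟩
      (a <F b) ∧ openAt (closer a) b                  ≡⟨ cong (_∧ openAt (closer a) b) (opener-<F a b) ⟨
      (opener a <F opener b) ∧ openAt (closer a) b    ≡⟨ ∧-assoc (opener a <F opener b) _ _ ⟨
      ((opener a <F opener b) ∧ (opener b <F closer a)) ∧ (closer a <F closer b) ∎

  -- Dually, openClosingEarlier vanishes at closers and counts crossings at openers.
  ∑-openClosingEarlier-split : ∑[ i < n ] openClosingEarlier i (w i) ≡
                               ∑[ i < n ] (if transient i then openClosingEarlier i (w i) else 0) + crossings
  ∑-openClosingEarlier-split = begin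
    ∑[ i < n ] V i
      ≡⟨ sum-cong-≗ split ⟩
    ∑[ i < n ] ((if transient i then V i else 0) + (if isOpener π i then V i else 0))
      ≡⟨ ∑-distrib-+ (λ i → if transient i then V i else 0) (λ i → if isOpener π i then V i else 0) ⟩
    ∑[ i < n ] (if transient i then V i else 0) + ∑[ i < n ] (if isOpener π i then V i else 0)
      ≡⟨ cong (∑[ i < n ] (if transient i then V i else 0) +_)
           (trans (∑-openers openClosingEarlier)
                  (∑-comm (λ a b → 𝟙 (openAt (opener a) b ∧ (closer b <F closer a))))) ⟩
    ∑[ i < n ] (if transient i then V i else 0) + crossings ∎
    where
    open ≡-Reasoning
    V : Fin n → ℕ
    V i = openClosingEarlier i (w i)
    split : ∀ i → V i ≡ (if transient i then V i else 0) + (if isOpener π i then V i else 0)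
    split i with transient i in tr | transient⊎opener⊎closer i
    ... | true  | _ rewrite isOpener≡ i | ==-false (transient⇒opener≢ tr) = sym (ℕ.+-identityʳ (V i))
    ... | false | inj₂ (inj₁ i≡o) rewrite isOpener≡ i | ==-true (sym i≡o) = refl
    ... | false | inj₂ (inj₂ i≡c) rewrite openClosingEarlier-at-closer (sym i≡c) = sym (if-eta (isOpener π i))

  ∑-opened-closingEarlier : ∀ i → ∑[ b < k ] 𝟙 ((opener b <F i) ∧ (closer b <F closer (w i))) ≡
                                  closedBefore i + openClosingEarlier i (w i)
  ∑-opened-closingEarlier i = trans (sum-cong-≗ split)
    (∑-distrib-+ (λ b → 𝟙 (closer b <F i)) (λ b → 𝟙 (openAt i b ∧ (closer b <F closer (w i)))))
    where
    split : ∀ b → 𝟙 ((opener b <F i) ∧ (closer b <F closer (w i))) ≡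
                  𝟙 (closer b <F i) + 𝟙 (openAt i b ∧ (closer b <F closer (w i)))
    split b with Fin.<-cmp (closer b) i
    ... | tri< c<i _ _ rewrite <ᵇ-true c<i | <ᵇ-true (ℕ.≤-<-trans (opener≤closer b) c<i)
                             | <ᵇ-false (ℕ.<⇒≤ c<i) | <ᵇ-true (ℕ.<-≤-trans c<i (≤-closer i)) = refl
    ... | tri≈ _ refl _ rewrite word-closer b | <ᵇ-irrefl (toℕ (closer b))
                              | ∧-zeroʳ (opener b <F closer b) = refl
    ... | tri> _ _ i<c rewrite <ᵇ-false (ℕ.<⇒≤ i<c) | <ᵇ-true i<c | ∧-identityʳ (opener b <F i) = refl

  not-transient-opener : ∀ b → transient (opener b) ≡ false
  not-transient-opener b = ¬-not λ tr → transient⇒opener≢ tr (cong opener (word-opener b))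

  not-transient-closer : ∀ b → transient (closer b) ≡ false
  not-transient-closer b = ¬-not λ tr → transient⇒closer≢ tr (cong closer (word-closer b))

  openAbove<open : ∀ {i} → transient i ≡ true → openAbove i (w i) ℕ.< ∑[ b < k ] 𝟙 (openAt i b)
  openAbove<open {i} tr = ∑-mono-< (λ b → 𝟙-mono (proj₁ ∘ ∧-true⁻)) (w i)
    (subst₂ (λ x y → 𝟙 x ℕ.< 𝟙 y) (sym not-above-itself) (sym tr) (ℕ.s≤s ℕ.z≤n))
    where
    not-above-itself : (openAt i (w i) ∧ (w i <F w i)) ≡ false
    not-above-itself = trans (cong (openAt i (w i) ∧_) (<ᵇ-irrefl (toℕ (w i)))) (∧-zeroʳ _)

record SameArcs {n k} (π π′ : SetPartition n k) : Set where
  field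
    same-opener : ∀ b → opener π b ≡ opener π′ b
    same-closer : ∀ b → closer π b ≡ closer π′ b

module _ {n k} {π π′ : SetPartition n k} (same : SameArcs π π′) where
  open SameArcs same

  openAt-sameArcs : ∀ i b → openAt π i b ≡ openAt π′ i b
  openAt-sameArcs i b = cong₂ _∧_ (cong (_<F i) (same-opener b)) (cong (i <F_) (same-closer b))

  openAbove-sameArcs : ∀ i a → openAbove π i a ≡ openAbove π′ i a
  openAbove-sameArcs i a = sum-cong-≗ λ b → cong (λ x → 𝟙 (x ∧ (a <F b))) (openAt-sameArcs i b)

  openClosingEarlier-sameArcs : ∀ i a → openClosingEarlier π i a ≡ openClosingEarlier π′ i a
  openClosingEarlier-sameArcs i a = sum-cong-≗ λ b →
    cong 𝟙 (cong₂ _∧_ (openAt-sameArcs i b) (cong₂ _<F_ (same-closer b) (same-closer a)))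

  closedBefore-sameArcs : ∀ i → closedBefore π i ≡ closedBefore π′ i
  closedBefore-sameArcs i = sum-cong-≗ λ b → cong (λ x → 𝟙 (x <F i)) (same-closer b)

  crossings-sameArcs : crossings π ≡ crossings π′
  crossings-sameArcs = sum-cong-≗ λ a → sum-cong-≗ λ b → cong 𝟙
    (cong₂ _∧_ (cong₂ _∧_ (cong₂ _<F_ (same-opener a) (same-opener b))
                          (cong₂ _<F_ (same-opener b) (same-closer a)))
               (cong₂ _<F_ (same-closer a) (same-closer b)))

record ArcPreserving {n k} (π : SetPartition n k) (w′ : Fin n → Fin k) : Set where
  field
    at-opener : ∀ b → w′ (opener π b) ≡ b
    at-closer : ∀ b → w′ (closer π b) ≡ b
    within    : ∀ j → opener π (w′ j) ≤ j × j ≤ closer π (w′ j)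

module _ {n k} {π : SetPartition n k} {w′ : Fin n → Fin k} (preserving : ArcPreserving π w′) where
  open ArcPreserving preserving

  arcPreserving-isBlockWord : IsBlockWord w′
  arcPreserving-isBlockWord =
    (λ b → opener π b , at-opener b) ,
    (λ j b b<w′j → opener π b , ℕ.<-≤-trans (opener-< π b<w′j) (proj₁ (within j)) , at-opener b)

  arcPreserving-sameArcs : SameArcs π (w′ , arcPreserving-isBlockWord)
  arcPreserving-sameArcs = record
    { same-opener = λ b → Fin.≤-antisym
        (subst (λ x → opener π x ≤ opener π′ b) (word-opener π′ b) (proj₁ (within (opener π′ b))))
        (opener-least π′ (opener π b) (at-opener b))
    ; same-closer = λ b → Fin.≤-antisym
        (closer-greatest π′ (closer π b) (at-closer b))
        (subst (λ x → closer π′ b ≤ closer π x) (word-closer π′ b) (proj₂ (within (closer π′ b))))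
    }
    where
    π′ : SetPartition _ _
    π′ = w′ , arcPreserving-isBlockWord

-- Switching

module _ {n k} (π : SetPartition n k) where

  private
    w = word π
    module OpenRank (i : Fin n) = Rank (openAt π i) (closer π) (λ _ _ → closer-injective π)

  -- At a transient position i, openAbove ranks w i among the blocks open at i by index from the top;
  -- switchWord i is the open block of that rank by closer from the bottom.
  opaque
    switchWord : Fin n → Fin k
    switchWord i = if transient π i then OpenRank.unrank i (w i) (openAbove π i (w i)) else w i

    switchWord-stable : ∀ {i} → transient π i ≡ false → switchWord i ≡ w i
    switchWord-stable tr rewrite tr = refl

    switchWord-transient : ∀ {i} → transient π i ≡ true →
      openAt π i (switchWord i) ≡ true × openClosingEarlier π i (switchWord i) ≡ openAbove π i (w i)
    switchWord-transient {i} tr rewrite tr = OpenRank.unrank-ranked i (w i) (openAbove<open π tr)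

  switchWord-unique : ∀ {i b} → transient π i ≡ true → openAt π i b ≡ true →
    openClosingEarlier π i b ≡ openAbove π i (w i) → switchWord i ≡ b
  switchWord-unique {i} tr open-b b-ranked =
    let open-σi , σi-ranked = switchWord-transient tr
    in OpenRank.rank-injective i open-σi open-b (trans σi-ranked (sym b-ranked))

  switchWord-arcPreserving : ArcPreserving π switchWord
  switchWord-arcPreserving = record
    { at-opener = λ b → trans (switchWord-stable (not-transient-opener π b)) (word-opener π b)
    ; at-closer = λ b → trans (switchWord-stable (not-transient-closer π b)) (word-closer π b)
    ; within    = within
    }
    where
    within : ∀ j → opener π (switchWord j) ≤ j × j ≤ closer π (switchWord j)
    within j with transient π j in tr
    ... | true  = let o<j , j<c = ∧-true⁻ (proj₁ (switchWord-transient tr))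
                  in ℕ.<⇒≤ (<ᵇ-true⁻ o<j) , ℕ.<⇒≤ (<ᵇ-true⁻ j<c)
    ... | false rewrite switchWord-stable tr = opener-≤ π j , ≤-closer π j

  switch : SetPartition n k
  switch = switchWord , arcPreserving-isBlockWord switchWord-arcPreserving

  switch-sameArcs : SameArcs π switch
  switch-sameArcs = arcPreserving-sameArcs switchWord-arcPreserving

  transient-switch : ∀ i → transient switch i ≡ transient π i
  transient-switch i = trans (sym (openAt-sameArcs switch-sameArcs i (switchWord i))) (still-open (transient π i) refl)
    where
    still-open : ∀ t → transient π i ≡ t → openAt π i (switchWord i) ≡ t
    still-open true  tr = proj₁ (switchWord-transient tr)
    still-open false tr = trans (cong (openAt π i) (switchWord-stable tr)) tr

  ∑-transient-switch : ∑[ i < n ] (if transient switch i then openClosingEarlier switch i (switchWord i) else 0) ≡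
                       ∑[ i < n ] (if transient π i then openAbove π i (w i) else 0)
  ∑-transient-switch = sum-cong-≗ summand
    where
    summand : ∀ i → (if transient switch i then openClosingEarlier switch i (switchWord i) else 0) ≡
                    (if transient π i then openAbove π i (w i) else 0)
    summand i rewrite transient-switch i with transient π i in tr
    ... | true  = trans (sym (openClosingEarlier-sameArcs switch-sameArcs i (switchWord i)))
                        (proj₂ (switchWord-transient tr))
    ... | false = refl

  mak-switch : mak π ≡ ∑[ i < n ] closedBefore switch i + ∑[ i < n ] openClosingEarlier switch i (switchWord i)
  mak-switch = begin
    mak π
      ≡⟨ mak≡∑closedBefore+∑openAbove π ⟩
    ∑[ i < n ] closedBefore π i + ∑[ i < n ] openAbove π i (w i)
      ≡⟨ cong (∑[ i < n ] closedBefore π i +_) (∑-openAbove-split π) ⟩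
    ∑[ i < n ] closedBefore π i + (∑[ i < n ] (if transient π i then openAbove π i (w i) else 0) + crossings π)
      ≡⟨ cong₂ _+_ (sum-cong-≗ (closedBefore-sameArcs switch-sameArcs))
                   (cong₂ _+_ (sym ∑-transient-switch) (crossings-sameArcs switch-sameArcs)) ⟩
    ∑[ i < n ] closedBefore switch i +
      (∑[ i < n ] (if transient switch i then openClosingEarlier switch i (switchWord i) else 0) + crossings switch)
      ≡⟨ cong (∑[ i < n ] closedBefore switch i +_) (∑-openClosingEarlier-split switch) ⟨
    ∑[ i < n ] closedBefore switch i + ∑[ i < n ] openClosingEarlier switch i (switchWord i) ∎
    where open ≡-Reasoning

-- Reversal

module _ {n k} (π : SetPartition n k) where

  private
    w = word π
    module ClosingRank =
      Rank (λ _ → true) (opposite ∘ closer π) (λ _ _ → closer-injective π ∘ opposite-injective)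

  -- The index of block b in the reversed partition, whose blocks are numbered by decreasing closer.
  opaque
    relabel : Fin k → Fin k
    relabel b = Fin.fromℕ< (subst (ClosingRank.rank b ℕ.<_) (∑-𝟙-true k) (ClosingRank.rank<size refl))

    toℕ-relabel : ∀ b → toℕ (relabel b) ≡ ClosingRank.rank b
    toℕ-relabel b = Fin.toℕ-fromℕ< _

  relabel-<F : ∀ a b → (relabel a <F relabel b) ≡ (closer π b <F closer π a)
  relabel-<F a b = trans (cong₂ ℕ._<ᵇ_ (toℕ-relabel a) (toℕ-relabel b))
                         (trans (ClosingRank.rank-<ᵇ refl refl) (opposite-<F (closer π a) (closer π b)))

  relabel-injective : ∀ {a b} → relabel a ≡ relabel b → a ≡ b
  relabel-injective {a} {b} ra≡rb = ClosingRank.rank-injective refl refl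
    (trans (sym (toℕ-relabel a)) (trans (cong toℕ ra≡rb) (toℕ-relabel b)))

  relabel-surjective : ∀ t → ∃ λ b → relabel b ≡ t
  relabel-surjective t
    with b , _ , rank-b ← ClosingRank.rank-surjective (subst (toℕ t ℕ.<_) (sym (∑-𝟙-true k)) (Fin.toℕ<n t))
    = b , Fin.toℕ-injective (trans (toℕ-relabel b) rank-b)

  ∑-relabel : (f : Fin k → ℕ) → ∑[ b < k ] f b ≡ ∑[ b < k ] f (relabel b)
  ∑-relabel f = ∑-bijection f relabel relabel-injective relabel-surjective

  reverseWord : Fin n → Fin k
  reverseWord j = relabel (w (opposite j))

  reverseWord-opposite : ∀ i → reverseWord (opposite i) ≡ relabel (w i)
  reverseWord-opposite i = cong (relabel ∘ w) (Fin.opposite-involutive i)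

  reverseWord-closer : ∀ b → reverseWord (opposite (closer π b)) ≡ relabel b
  reverseWord-closer b = trans (reverseWord-opposite (closer π b)) (cong relabel (word-closer π b))

  reverseWord-opener : ∀ b → reverseWord (opposite (opener π b)) ≡ relabel b
  reverseWord-opener b = trans (reverseWord-opposite (opener π b)) (cong relabel (word-opener π b))

  reverseWord-isBlockWord : IsBlockWord reverseWord
  reverseWord-isBlockWord = surjective , restrictedGrowth
    where
    surjective : ∀ t → ∃ λ j → reverseWord j ≡ t
    surjective t with b , rb≡t ← relabel-surjective t = opposite (closer π b) , trans (reverseWord-closer b) rb≡t
    restrictedGrowth : ∀ j t → t < reverseWord j → ∃ λ m → m < j × reverseWord m ≡ t
    restrictedGrowth j t t<rβ with b , refl ← relabel-surjective t =
      opposite (closer π b) , mirrored-before-j , reverseWord-closer b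
      where
      β : Fin k
      β = w (opposite j)
      cβ<cb : closer π β < closer π b
      cβ<cb = <ᵇ-true⁻ (trans (sym (relabel-<F b β)) (<ᵇ-true t<rβ))
      mirrored-before-j : opposite (closer π b) < j
      mirrored-before-j = subst (opposite (closer π b) <_) (Fin.opposite-involutive j)
                                (opposite-< (ℕ.≤-<-trans (≤-closer π (opposite j)) cβ<cb))

  reverse : SetPartition n k
  reverse = reverseWord , reverseWord-isBlockWord

  opener-reverse : ∀ b → opener reverse (relabel b) ≡ opposite (closer π b)
  opener-reverse b = Fin.≤-antisym (opener-least reverse (opposite (closer π b)) (reverseWord-closer b))
    (subst (opposite (closer π b) ≤_) (Fin.opposite-involutive j)
      (opposite-≤ (closer-greatest π (opposite j) (relabel-injective (word-opener reverse (relabel b))))))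
    where
    j : Fin n
    j = opener reverse (relabel b)

  closer-reverse : ∀ b → closer reverse (relabel b) ≡ opposite (opener π b)
  closer-reverse b = Fin.≤-antisym
    (subst (_≤ opposite (opener π b)) (Fin.opposite-involutive j)
      (opposite-≤ (opener-least π (opposite j) (relabel-injective (word-closer reverse (relabel b))))))
    (closer-greatest reverse (opposite (opener π b)) (reverseWord-opener b))
    where
    j : Fin n
    j = closer reverse (relabel b)

  isCloser-reverse : ∀ j → isCloser reverse (opposite j) ≡ isOpener π j
  isCloser-reverse j = begin
    isCloser reverse (opposite j)
      ≡⟨ isCloser≡ reverse (opposite j) ⟩
    closer reverse (reverseWord (opposite j)) == opposite j
      ≡⟨ cong (λ x → closer reverse x == opposite j) (reverseWord-opposite j) ⟩
    closer reverse (relabel (w j)) == opposite j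
      ≡⟨ cong (_== opposite j) (closer-reverse (w j)) ⟩
    opposite (opener π (w j)) == opposite j
      ≡⟨ ==-opposite (opener π (w j)) j ⟩
    opener π (w j) == j
      ≡⟨ isOpener≡ π j ⟨
    isOpener π j ∎
    where open ≡-Reasoning

  openAt-reverse : ∀ i b → openAt reverse (opposite i) (relabel b) ≡ openAt π i b
  openAt-reverse i b = begin
    (opener reverse (relabel b) <F opposite i) ∧ (opposite i <F closer reverse (relabel b))
      ≡⟨ cong₂ (λ o c → (o <F opposite i) ∧ (opposite i <F c)) (opener-reverse b) (closer-reverse b) ⟩
    (opposite (closer π b) <F opposite i) ∧ (opposite i <F opposite (opener π b))
      ≡⟨ cong₂ _∧_ (opposite-<F (closer π b) i) (opposite-<F i (opener π b)) ⟩
    (i <F closer π b) ∧ (opener π b <F i)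
      ≡⟨ ∧-comm (i <F closer π b) (opener π b <F i) ⟩
    openAt π i b ∎
    where open ≡-Reasoning

  transient-reverse : ∀ i → transient reverse (opposite i) ≡ transient π i
  transient-reverse i = trans (cong (openAt reverse (opposite i)) (reverseWord-opposite i)) (openAt-reverse i (w i))

  openAbove-reverse : ∀ i a → openAbove reverse (opposite i) (relabel a) ≡ openClosingEarlier π i a
  openAbove-reverse i a = trans (∑-relabel _) (sum-cong-≗ λ b →
    cong 𝟙 (cong₂ _∧_ (openAt-reverse i b) (relabel-<F a b)))

  openClosingEarlier-reverse : ∀ i a → openClosingEarlier reverse (opposite i) (relabel a) ≡ openAbove π i a
  openClosingEarlier-reverse i a = trans (∑-relabel _) (sum-cong-≗ λ b →
    cong 𝟙 (cong₂ _∧_ (openAt-reverse i b)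
      (trans (cong₂ _<F_ (closer-reverse b) (closer-reverse a))
             (trans (opposite-<F (opener π b) (opener π a)) (opener-<F π a b)))))

  mak′-reverse : mak′ reverse ≡ ∑[ i < n ] closedBefore π i + ∑[ i < n ] openClosingEarlier π i (w i)
  mak′-reverse = begin
    lob reverse + rcb reverse
      ≡⟨ cong (_+ rcb reverse) (lob≡0 reverse) ⟩
    sumOver reverse (rcb-at reverse)
      ≡⟨ trans (sumOver≡∑ (rcb-at reverse)) (∑-reverse (rcb-at reverse)) ⟩
    ∑[ i < n ] rcb-at reverse (opposite i)
      ≡⟨ sum-cong-≗ rcb-at-reverse ⟩
    ∑[ i < n ] (closedBefore π i + openClosingEarlier π i (w i))
      ≡⟨ ∑-distrib-+ (closedBefore π) (λ i → openClosingEarlier π i (w i)) ⟩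
    ∑[ i < n ] closedBefore π i + ∑[ i < n ] openClosingEarlier π i (w i) ∎
    where
    open ≡-Reasoning
    rcb-at-reverse : ∀ i → rcb-at reverse (opposite i) ≡ closedBefore π i + openClosingEarlier π i (w i)
    rcb-at-reverse i = begin
      rcb-at reverse (opposite i)                    ≡⟨ count≡∑ later-closer-above ⟩
      ∑[ j < n ] 𝟙 (later-closer-above j)            ≡⟨ ∑-reverse (𝟙 ∘ later-closer-above) ⟩
      ∑[ j < n ] 𝟙 (later-closer-above (opposite j)) ≡⟨ sum-cong-≗ (cong 𝟙 ∘ mirrored) ⟩
      ∑[ j < n ] 𝟙 (earlier-opener-closing-before j) ≡⟨ count≡∑ earlier-opener-closing-before ⟨
      count earlier-opener-closing-before
        ≡⟨ count-openers π (λ j b → (j <F i) ∧ (closer π b <F closer π (w i))) ⟩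
      ∑[ b < k ] 𝟙 ((opener π b <F i) ∧ (closer π b <F closer π (w i)))
        ≡⟨ ∑-opened-closingEarlier π i ⟩
      closedBefore π i + openClosingEarlier π i (w i) ∎
      where
      later-closer-above earlier-opener-closing-before : Fin n → Bool
      later-closer-above j = isCloser reverse j ∧ (opposite i <F j) ∧ (reverseWord (opposite i) <F reverseWord j)
      earlier-opener-closing-before j = isOpener π j ∧ (j <F i) ∧ (closer π (w j) <F closer π (w i))
      mirrored : ∀ j → later-closer-above (opposite j) ≡ earlier-opener-closing-before j
      mirrored j = cong₂ _∧_ (isCloser-reverse j) (cong₂ _∧_ (opposite-<F i j)
        (trans (cong₂ _<F_ (reverseWord-opposite i) (reverseWord-opposite j)) (relabel-<F (w i) (w j))))

relabel-reverse-relabel : ∀ {n k} (π : SetPartition n k) b → relabel (reverse π) (relabel π b) ≡ b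
relabel-reverse-relabel {k = k} π b = Fin.toℕ-injective (begin
  toℕ (relabel (reverse π) (relabel π b))
    ≡⟨ toℕ-relabel (reverse π) (relabel π b) ⟩
  ∑[ x < k ] 𝟙 (opposite (closer (reverse π) x) <F opposite (closer (reverse π) (relabel π b)))
    ≡⟨ ∑-relabel π _ ⟩
  ∑[ a < k ] 𝟙 (opposite (closer (reverse π) (relabel π a)) <F opposite (closer (reverse π) (relabel π b)))
    ≡⟨ sum-cong-≗ (λ a → cong 𝟙 (trans
         (cong₂ (λ x y → opposite x <F opposite y) (closer-reverse π a) (closer-reverse π b))
         (trans (cong₂ _<F_ (Fin.opposite-involutive (opener π a)) (Fin.opposite-involutive (opener π b)))
                (opener-<F π a b)))) ⟩
  ∑[ a < k ] 𝟙 (a <F b)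
    ≡⟨ ∑-𝟙-<F b ⟩
  toℕ b ∎)
  where open ≡-Reasoning

relabel-sameArcs : ∀ {n k} {π π′ : SetPartition n k} → SameArcs π π′ → ∀ b → relabel π b ≡ relabel π′ b
relabel-sameArcs {π = π} {π′} same b = Fin.toℕ-injective (begin
  toℕ (relabel π b)   ≡⟨ toℕ-relabel π b ⟩
  ∑[ a < _ ] 𝟙 (opposite (closer π a) <F opposite (closer π b))
    ≡⟨ sum-cong-≗ (λ a → cong₂ (λ x y → 𝟙 (opposite x <F opposite y)) (same-closer a) (same-closer b)) ⟩
  ∑[ a < _ ] 𝟙 (opposite (closer π′ a) <F opposite (closer π′ b))
    ≡⟨ toℕ-relabel π′ b ⟨
  toℕ (relabel π′ b)  ∎)
  where
  open ≡-Reasoning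
  open SameArcs same

-- The involution

φ : ∀ {n k} → SetPartition n k → SetPartition n k
φ = reverse ∘ switch

mak≡mak′∘φ : ∀ {n k} (π : SetPartition n k) → mak π ≡ mak′ (φ π)
mak≡mak′∘φ π = trans (mak-switch π) (sym (mak′-reverse (switch π)))

-- Reversal exchanges the two rankings of the blocks open at a position, so the second switch undoes the first.
switch-reverse-switch : ∀ {n k} (π : SetPartition n k) i →
  switchWord (reverse (switch π)) (opposite i) ≡ relabel (switch π) (word π i)
switch-reverse-switch {n} {k} π i = by-cases (transient π i) refl
  where
  open ≡-Reasoning
  π₁ π₂ : SetPartition n k
  π₁ = switch π
  π₂ = reverse π₁
  transient-π₂ : transient π₂ (opposite i) ≡ transient π i
  transient-π₂ = trans (transient-reverse π₁ i) (transient-switch π i)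
  by-cases : ∀ t → transient π i ≡ t → switchWord π₂ (opposite i) ≡ relabel π₁ (word π i)
  by-cases false tr = begin
    switchWord π₂ (opposite i)   ≡⟨ switchWord-stable π₂ (trans transient-π₂ tr) ⟩
    reverseWord π₁ (opposite i)  ≡⟨ reverseWord-opposite π₁ i ⟩
    relabel π₁ (switchWord π i)  ≡⟨ cong (relabel π₁) (switchWord-stable π tr) ⟩
    relabel π₁ (word π i)        ∎
  by-cases true tr = switchWord-unique π₂ (trans transient-π₂ tr) opens ranked
    where
    opens : openAt π₂ (opposite i) (relabel π₁ (word π i)) ≡ true
    opens = trans (openAt-reverse π₁ i (word π i)) (trans (sym (openAt-sameArcs (switch-sameArcs π) i (word π i))) tr)
    ranked : openClosingEarlier π₂ (opposite i) (relabel π₁ (word π i)) ≡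
             openAbove π₂ (opposite i) (word π₂ (opposite i))
    ranked = begin
      openClosingEarlier π₂ (opposite i) (relabel π₁ (word π i))
        ≡⟨ openClosingEarlier-reverse π₁ i (word π i) ⟩
      openAbove π₁ i (word π i)
        ≡⟨ openAbove-sameArcs (switch-sameArcs π) i (word π i) ⟨
      openAbove π i (word π i)
        ≡⟨ proj₂ (switchWord-transient π tr) ⟨
      openClosingEarlier π i (switchWord π i)
        ≡⟨ openClosingEarlier-sameArcs (switch-sameArcs π) i (switchWord π i) ⟩
      openClosingEarlier π₁ i (word π₁ i)
        ≡⟨ openAbove-reverse π₁ i (word π₁ i) ⟨
      openAbove π₂ (opposite i) (relabel π₁ (word π₁ i))
        ≡⟨ cong (openAbove π₂ (opposite i)) (reverseWord-opposite π₁ i) ⟨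
      openAbove π₂ (opposite i) (word π₂ (opposite i)) ∎

φ-involutive : ∀ {n k} (π : SetPartition n k) i → word (φ (φ π)) i ≡ word π i
φ-involutive {n} {k} π i = begin
  relabel π₃ (switchWord π₂ (opposite i))  ≡⟨ cong (relabel π₃) (switch-reverse-switch π i) ⟩
  relabel π₃ (relabel π₁ (word π i))       ≡⟨ relabel-sameArcs (switch-sameArcs π₂) (relabel π₁ (word π i)) ⟨
  relabel π₂ (relabel π₁ (word π i))       ≡⟨ relabel-reverse-relabel π₁ (word π i) ⟩
  word π i                                 ∎
  where
  open ≡-Reasoning
  π₁ π₂ π₃ : SetPartition n k
  π₁ = switch π
  π₂ = reverse π₁
  π₃ = switch π₂

mainTheorem2 : (n k : ℕ) → n ≥ 1 → k ≥ 1 →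
    Σ (SetPartition n k → SetPartition n k) λ φ →
      ((π : SetPartition n k) (i : Fin n) → word (φ (φ π)) i ≡ word π i) ×
      ((π : SetPartition n k) → mak π ≡ mak′ (φ π))
mainTheorem2 n k _ _ = φ , φ-involutive , mak≡mak′∘φ
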